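{- For any positive integers $r$ and $n$ with $\omega(n)\geq 2$ and $n\in F_r$, \[P_1(n)<Q_1(n)\left(1-J_r+\frac{J_r}{r}Q_1(n)\right).\]
   Context: $\omega(n)$ is the number of distinct prime factors of $n$. For a positive integer $r$, $S_r$ is the multiplicative function with $S_r(q^\alpha)=0$ if $q\le r$ and $S_r(q^\alpha)=q^{\alpha-1}(q-r)$ if $q>r$. $B_r=\{n\in\mathbb{N}: S_r(n)>0\}$. $F_r$ is the set of $n\in B_r$ with $S_r(n)<S_r(m)$ for all $m\in B_r$, $m>n$. $P_1(n)$ is the largest prime divisor of $n$; $Q_1(n)$ is the smallest prime that is larger than $r$ and does not divide $n$. $r\#$ is the product of all primes $\le r$ (with $1\#=1$); the Jacobsthal function $J(N)$ is the smallest positive integer $a$ such that every set of $a$ consecutive integers contains an element coprime to $N$; $J_r=J(r\#)$. -}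

module Defs where

open import Data.Nat using (ℕ; zero; suc; _+_; _*_; _∸_; _^_; _≤_; _<_; _⊔_; _/_)
open import Data.Nat.Divisibility using (_∣_; _∣?_)
open import Data.Nat.Primality using (Prime; prime?)
open import Data.Nat.Coprimality using (Coprime)
open import Data.Integer using (ℤ; ∣_∣) renaming (_+_ to _+ℤ_; +_ to ℤ+)
open import Data.Product using (Σ; ∃; _×_)
open import Relation.Nullary using (yes; no; ¬_)

prodTo : ℕ → (ℕ → ℕ) → ℕ
prodTo zero    f = f zero
prodTo (suc n) f = prodTo n f * f (suc n)

sumTo : ℕ → (ℕ → ℕ) → ℕ
sumTo zero    f = f zero
sumTo (suc n) f = sumTo n f + f (suc n)

isPrimeDivisor : ℕ → ℕ → ℕ
isPrimeDivisor n q with prime? q | q ∣? n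
... | yes _ | yes _ = 1
... | _     | _     = 0

-- valuation with fuel: val k q n = multiplicity of q in n (for fuel k ≥ that multiplicity)
valF : ℕ → ℕ → ℕ → ℕ
valF zero    q             n       = 0
valF (suc k) (suc (suc q)) (suc n) with suc (suc q) ∣? suc n
... | yes _ = suc (valF k (suc (suc q)) (suc n / suc (suc q)))
... | no  _ = 0
valF (suc k) _             _       = 0

-- v_q(n) (fuel n suffices since q ≥ 2)
val : ℕ → ℕ → ℕ
val q n = valF n q n

ω : ℕ → ℕ
ω n = sumTo n (isPrimeDivisor n)

-- local factor of S_r at q: q^(α-1) (q ∸ r) if q is a prime dividing n
-- (with α = v_q(n)); note q ∸ r = 0 exactly when q ≤ r, matching S_r(q^α) = 0.
-- Otherwise 1.
Sfactor : ℕ → ℕ → ℕ → ℕ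
Sfactor r n q with prime? q | q ∣? n
... | yes _ | yes _ = q ^ (val q n ∸ 1) * (q ∸ r)
... | _     | _     = 1

S : ℕ → ℕ → ℕ
S r n = prodTo n (Sfactor r n)

B : ℕ → ℕ → Set
B r n = (1 ≤ n) × (0 < S r n)

F : ℕ → ℕ → Set
F r n = B r n × (∀ m → B r m → n < m → S r n < S r m)

IsP₁ : ℕ → ℕ → Set
IsP₁ n p = Prime p × p ∣ n × (∀ q → Prime q → q ∣ n → q ≤ p)

IsQ₁ : ℕ → ℕ → ℕ → Set
IsQ₁ r n q = Prime q × r < q × ¬ (q ∣ n)
           × (∀ p → Prime p → r < p → ¬ (p ∣ n) → q ≤ p)

primeOrOne : ℕ → ℕ
primeOrOne q with prime? q
... | yes _ = q
... | no  _ = 1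

primorial : ℕ → ℕ
primorial r = prodTo r primeOrOne

JGood : ℕ → ℕ → Set
JGood N a = ∀ (x : ℤ) → ∃ λ i → i < a × Coprime ∣ x +ℤ ℤ+ i ∣ N

IsJ : ℕ → ℕ → Set
IsJ N a = (0 < a) × JGood N a × (∀ b → 0 < b → JGood N b → a ≤ b)

-- Let p be a prime divisor of n and q > r a prime not dividing n, and suppose the bound
-- fails: r q + J q² ≤ r p + r J q. Write n = A p. Since J = J(r#), one of the J integers
-- after ⌊p/q⌋ is some t coprime to r#, so all prime factors of t exceed r, and
-- p < t q ≤ p + J q. Then m = A q t > n lies in B_r, and multiplicativity of S_r
-- (with S_r(ℓ^(a+1)) ≤ ℓ S_r(ℓ^a)) gives S_r(m) ≤ (q − r) t S_r(A) ≤ (p − r) S_r(A) ≤ S_r(n);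
-- the middle inequality is exactly the failed bound. This contradicts n ∈ F_r.

module Submission where

module Products where

  open import Data.Nat
  open import Data.Nat.Properties
  open import Algebra.Properties.CommutativeSemigroup *-commutativeSemigroup using (x∙yz≈y∙xz)
  open import Data.Nat.Divisibility using (_∣_; ∣-refl; ∣-trans; m∣m*n; n∣m*n)
  open import Function using (_∘_)
  open import Relation.Binary.PropositionalEquality
  open import Relation.Nullary using (yes; no)
  open import Defs using (prodTo)

  prodTo-cong : ∀ N {f g : ℕ → ℕ} → (∀ {k} → k ≤ N → f k ≡ g k) → prodTo N f ≡ prodTo N g
  prodTo-cong zero    f≗g = f≗g z≤n
  prodTo-cong (suc N) f≗g = cong₂ _*_ (prodTo-cong N (f≗g ∘ m≤n⇒m≤1+n)) (f≗g ≤-refl)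

  prodTo-extend : ∀ {n N} (f : ℕ → ℕ) → n ≤′ N → (∀ {k} → n < k → f k ≡ 1)
    → prodTo N f ≡ prodTo n f
  prodTo-extend f ≤′-refl            _   = refl
  prodTo-extend {n} f (≤′-step {N} n≤′N) f≡1 = begin
    prodTo N f * f (suc N) ≡⟨ cong₂ _*_ (prodTo-extend f n≤′N f≡1) (f≡1 (s≤s (≤′⇒≤ n≤′N))) ⟩
    prodTo n f * 1         ≡⟨ *-identityʳ _ ⟩
    prodTo n f             ∎
    where open ≡-Reasoning

  prodTo-scale-at : ∀ N {f g : ℕ → ℕ} {q} c → q ≤ N
    → (∀ {k} → k ≢ q → f k ≡ g k) → f q ≡ c * g q → prodTo N f ≡ c * prodTo N g
  prodTo-scale-at zero    c z≤n _ fq = fq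
  prodTo-scale-at (suc N) {f} {g} {q} c q≤1+N f≗g fq with q ≟ suc N
  ... | yes refl = begin
    prodTo N f * f (suc N)   ≡⟨ cong₂ _*_ (prodTo-cong N (λ k≤N → f≗g (<⇒≢ (s≤s k≤N)))) fq ⟩
    prodTo N g * (c * g q)   ≡⟨ x∙yz≈y∙xz (prodTo N g) c (g q) ⟩
    c * (prodTo N g * g q)   ∎
    where open ≡-Reasoning
  ... | no q≢1+N = begin
    prodTo N f * f (suc N)       ≡⟨ cong₂ _*_ (prodTo-scale-at N c q≤N f≗g fq) (f≗g (q≢1+N ∘ sym)) ⟩
    c * prodTo N g * g (suc N)   ≡⟨ *-assoc c _ _ ⟩
    c * (prodTo N g * g (suc N)) ∎
    where open ≡-Reasoning
          q≤N = ≤-pred (≤∧≢⇒< q≤1+N q≢1+N)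

  ∣-prodTo : ∀ N (f : ℕ → ℕ) {k} → k ≤ N → f k ∣ prodTo N f
  ∣-prodTo zero    f z≤n  = ∣-refl
  ∣-prodTo (suc N) f {k} k≤1+N with k ≟ suc N
  ... | yes refl = n∣m*n (prodTo N f)
  ... | no k≢1+N = ∣-trans (∣-prodTo N f (≤-pred (≤∧≢⇒< k≤1+N k≢1+N))) (m∣m*n (f (suc N)))

module Valuation where

  open import Data.Nat
  open import Data.Nat.Properties
  open import Data.Nat.Divisibility
  open import Data.Nat.DivMod using (_/_; *-/-assoc; m*n/n≡m; m/n<m; m≥n⇒m/n>0)
  open import Data.Nat.Primality
  open import Data.Sum using (inj₁; inj₂)
  open import Function using (_∘′_)
  open import Relation.Nullary
  open import Relation.Binary.PropositionalEquality
  open import Defs using (valF; val)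

  ∣-prime⇒≡ : ∀ {k q} → Prime k → Prime q → k ∣ q → k ≡ q
  ∣-prime⇒≡ pk pq k∣q with prime⇒irreducible pq k∣q
  ... | inj₁ refl = contradiction pk ¬prime[1]
  ... | inj₂ k≡q  = k≡q

  ∤-*-prime : ∀ {k q} n → Prime k → Prime q → k ≢ q → ¬ k ∣ n → ¬ k ∣ n * q
  ∤-*-prime n pk pq k≢q k∤n k∣nq with euclidsLemma n _ pk k∣nq
  ... | inj₁ k∣n = k∤n k∣n
  ... | inj₂ k∣q = k≢q (∣-prime⇒≡ pk pq k∣q)

  private
    valF-∣ : ∀ fuel k n → 2+ k ∣ suc n
      → valF (suc fuel) (2+ k) (suc n) ≡ suc (valF fuel (2+ k) (suc n / 2+ k))
    valF-∣ fuel k n k∣n with 2+ k ∣? suc n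
    ... | yes _   = refl
    ... | no  k∤n = contradiction k∣n k∤n

    valF-∤ : ∀ fuel k n → ¬ 2+ k ∣ suc n → valF (suc fuel) (2+ k) (suc n) ≡ 0
    valF-∤ fuel k n k∤n with 2+ k ∣? suc n
    ... | yes k∣n = contradiction k∣n k∤n
    ... | no  _   = refl

    valF-0 : ∀ fuel k → valF fuel (2+ k) 0 ≡ 0
    valF-0 zero     k = refl
    valF-0 (suc _)  k = refl

    valF-fuel : ∀ {f g} k n → n ≤ f → n ≤ g → valF f (2+ k) n ≡ valF g (2+ k) n
    valF-fuel {f} {g} k zero _ _ = trans (valF-0 f k) (sym (valF-0 g k))
    valF-fuel {suc f} {suc g} k (suc n) (s≤s n≤f) (s≤s n≤g) with 2+ k ∣? suc n
    ... | yes _ = cong suc (valF-fuel k (suc n / 2+ k) (quotient≤ n≤f) (quotient≤ n≤g))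
      where
      quotient≤ : ∀ {h} → n ≤ h → suc n / 2+ k ≤ h
      quotient≤ n≤h = ≤-pred (<-≤-trans (m/n<m (suc n) (2+ k) (s≤s (s≤s z≤n))) (s≤s n≤h))
    ... | no _ = refl

    valF-*-≢ : ∀ {k q} → Prime (2+ k) → Prime (suc q) → 2+ k ≢ suc q
      → ∀ fuel n → 1 ≤ n → valF fuel (2+ k) (n * suc q) ≡ valF fuel (2+ k) n
    valF-*-≢ pk pq k≢q zero n _ = refl
    valF-*-≢ {k} {q} pk pq k≢q (suc fuel) (suc n) _ = by-cases (2+ k ∣? suc n)
      where
      open ≡-Reasoning
      by-cases : Dec (2+ k ∣ suc n) → valF (suc fuel) (2+ k) (suc n * suc q) ≡ valF (suc fuel) (2+ k) (suc n)
      by-cases (no k∤n) = trans (valF-∤ fuel k _ (∤-*-prime (suc n) pk pq k≢q k∤n)) (sym (valF-∤ fuel k n k∤n))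
      by-cases (yes k∣n) = begin
        valF (suc fuel) (2+ k) (suc n * suc q)         ≡⟨ valF-∣ fuel k _ (∣-trans k∣n (m∣m*n (suc q))) ⟩
        suc (valF fuel (2+ k) (suc n * suc q / 2+ k))  ≡⟨ cong (suc ∘′ valF fuel (2+ k)) quotient-*-comm ⟩
        suc (valF fuel (2+ k) (suc n / 2+ k * suc q))  ≡⟨ cong suc (valF-*-≢ pk pq k≢q fuel _ (m≥n⇒m/n>0 (∣⇒≤ k∣n))) ⟩
        suc (valF fuel (2+ k) (suc n / 2+ k))          ≡⟨ valF-∣ fuel k n k∣n ⟨
        valF (suc fuel) (2+ k) (suc n)                 ∎
        where
        quotient-*-comm : suc n * suc q / 2+ k ≡ suc n / 2+ k * suc q
        quotient-*-comm = begin
          suc n * suc q / 2+ k    ≡⟨ cong (_/ 2+ k) (*-comm (suc n) (suc q)) ⟩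
          suc q * suc n / 2+ k    ≡⟨ *-/-assoc (suc q) k∣n ⟩
          suc q * (suc n / 2+ k)  ≡⟨ *-comm (suc q) _ ⟩
          suc n / 2+ k * suc q    ∎

  val-*-≢ : ∀ {k q n} → Prime k → Prime q → k ≢ q → 1 ≤ n → val k (n * q) ≡ val k n
  val-*-≢ {0}    (prime {{()}} _) _ _ _
  val-*-≢ {1}    (prime {{()}} _) _ _ _
  val-*-≢ {2+ k} {0} _ (prime {{()}} _) _ _
  val-*-≢ {2+ k} {suc q} {n} pk pq k≢q 1≤n =
    trans (valF-*-≢ pk pq k≢q (n * suc q) n 1≤n) (valF-fuel k n (m≤m*n n (suc q)) ≤-refl)

  val-*-self : ∀ {q n} → Prime q → 1 ≤ n → val q (n * q) ≡ suc (val q n)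
  val-*-self {0}    (prime {{()}} _) _
  val-*-self {1}    (prime {{()}} _) _
  val-*-self {2+ k} {suc n} _ _ = begin
    valF (suc fuel) (2+ k) (suc n * 2+ k)          ≡⟨ valF-∣ fuel k _ (n∣m*n (suc n)) ⟩
    suc (valF fuel (2+ k) (suc n * 2+ k / 2+ k))   ≡⟨ cong (suc ∘′ valF fuel (2+ k)) (m*n/n≡m (suc n) (2+ k)) ⟩
    suc (valF fuel (2+ k) (suc n))                 ≡⟨ cong suc (valF-fuel k (suc n) n≤fuel ≤-refl) ⟩
    suc (val (2+ k) (suc n))                       ∎
    where
    open ≡-Reasoning
    fuel : ℕ
    fuel = suc k + n * 2+ k
    n≤fuel : suc n ≤ fuel
    n≤fuel = s≤s (≤-trans (m≤m*n n (2+ k)) (m≤n+m _ k))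

  val-∤ : ∀ {q n} → Prime q → 1 ≤ n → ¬ q ∣ n → val q n ≡ 0
  val-∤ {0}    (prime {{()}} _) _ _
  val-∤ {1}    (prime {{()}} _) _ _
  val-∤ {2+ k} {suc n} _ _ q∤n = valF-∤ n k n q∤n

  val-∣ : ∀ {q n} → Prime q → 1 ≤ n → q ∣ n → 1 ≤ val q n
  val-∣ {0}    (prime {{()}} _) _ _
  val-∣ {1}    (prime {{()}} _) _ _
  val-∣ {2+ k} {suc n} _ _ q∣n rewrite valF-∣ n k n q∣n = s≤s z≤n

module Multiplicativity where

  open import Data.Nat
  open import Data.Nat.Properties
  open import Data.Nat.Divisibility
  open import Data.Nat.Primality
  open import Relation.Nullary
  open import Relation.Binary.PropositionalEquality
  open import Defs using (Sfactor; S; val; prodTo)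
  open Products
  open Valuation

  Sfactor-∤ : ∀ r {n k} → ¬ k ∣ n → Sfactor r n k ≡ 1
  Sfactor-∤ r {n} {k} k∤n with prime? k | k ∣? n
  ... | yes _ | yes k∣n = contradiction k∣n k∤n
  ... | yes _ | no  _   = refl
  ... | no  _ | _       = refl

  Sfactor-¬prime : ∀ r {n k} → ¬ Prime k → Sfactor r n k ≡ 1
  Sfactor-¬prime r {n} {k} ¬pk with prime? k | k ∣? n
  ... | yes pk | _ = contradiction pk ¬pk
  ... | no  _  | _ = refl

  Sfactor-∣ : ∀ r {n k} → Prime k → k ∣ n → Sfactor r n k ≡ k ^ (val k n ∸ 1) * (k ∸ r)
  Sfactor-∣ r {n} {k} pk k∣n with prime? k | k ∣? n
  ... | yes _ | yes _   = refl
  ... | yes _ | no  k∤n = contradiction k∣n k∤n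
  ... | no ¬pk | _      = contradiction pk ¬pk

  Sfactor-*-≢ : ∀ r {n q k} → Prime q → 1 ≤ n → k ≢ q → Sfactor r (n * q) k ≡ Sfactor r n k
  Sfactor-*-≢ r {n} {q} {k} pq 1≤n k≢q = by-cases (prime? k) (k ∣? n)
    where
    open ≡-Reasoning
    by-cases : Dec (Prime k) → Dec (k ∣ n) → Sfactor r (n * q) k ≡ Sfactor r n k
    by-cases (no ¬pk) _         = trans (Sfactor-¬prime r ¬pk) (sym (Sfactor-¬prime r ¬pk))
    by-cases (yes pk) (no k∤n)  = trans (Sfactor-∤ r (∤-*-prime n pk pq k≢q k∤n)) (sym (Sfactor-∤ r k∤n))
    by-cases (yes pk) (yes k∣n) = begin
      Sfactor r (n * q) k                 ≡⟨ Sfactor-∣ r pk (∣-trans k∣n (m∣m*n q)) ⟩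
      k ^ (val k (n * q) ∸ 1) * (k ∸ r)   ≡⟨ cong (λ v → k ^ (v ∸ 1) * (k ∸ r)) (val-*-≢ pk pq k≢q 1≤n) ⟩
      k ^ (val k n ∸ 1) * (k ∸ r)         ≡⟨ Sfactor-∣ r pk k∣n ⟨
      Sfactor r n k                       ∎

  Sfactor-*-∤ : ∀ r {n q} → Prime q → 1 ≤ n → ¬ q ∣ n → Sfactor r (n * q) q ≡ (q ∸ r) * Sfactor r n q
  Sfactor-*-∤ r {n} {q} pq 1≤n q∤n = begin
    Sfactor r (n * q) q                ≡⟨ Sfactor-∣ r pq (n∣m*n n) ⟩
    q ^ (val q (n * q) ∸ 1) * (q ∸ r)  ≡⟨ cong (λ v → q ^ (v ∸ 1) * (q ∸ r)) (val-*-self pq 1≤n) ⟩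
    q ^ val q n * (q ∸ r)              ≡⟨ cong (λ v → q ^ v * (q ∸ r)) (val-∤ pq 1≤n q∤n) ⟩
    1 * (q ∸ r)                        ≡⟨ *-comm 1 (q ∸ r) ⟩
    (q ∸ r) * 1                        ≡⟨ cong ((q ∸ r) *_) (Sfactor-∤ r q∤n) ⟨
    (q ∸ r) * Sfactor r n q            ∎
    where open ≡-Reasoning

  Sfactor-*-∣ : ∀ r {n q} → Prime q → 1 ≤ n → q ∣ n → Sfactor r (n * q) q ≡ q * Sfactor r n q
  Sfactor-*-∣ r {n} {q} pq 1≤n q∣n = begin
    Sfactor r (n * q) q                  ≡⟨ Sfactor-∣ r pq (n∣m*n n) ⟩
    q ^ (val q (n * q) ∸ 1) * (q ∸ r)    ≡⟨ cong (λ v → q ^ (v ∸ 1) * (q ∸ r)) (val-*-self pq 1≤n) ⟩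
    q ^ val q n * (q ∸ r)                ≡⟨ cong (λ v → q ^ v * (q ∸ r)) (m+[n∸m]≡n (val-∣ pq 1≤n q∣n)) ⟨
    q * q ^ (val q n ∸ 1) * (q ∸ r)      ≡⟨ *-assoc q _ _ ⟩
    q * (q ^ (val q n ∸ 1) * (q ∸ r))    ≡⟨ cong (q *_) (Sfactor-∣ r pq q∣n) ⟨
    q * Sfactor r n q                    ∎
    where open ≡-Reasoning

  prodTo-Sfactor : ∀ r {n N} → 1 ≤ n → n ≤ N → prodTo N (Sfactor r n) ≡ S r n
  prodTo-Sfactor r {n} 1≤n n≤N = prodTo-extend (Sfactor r n) (≤⇒≤′ n≤N) λ n<k →
    Sfactor-∤ r λ k∣n → <⇒≱ n<k (∣⇒≤ {{>-nonZero 1≤n}} k∣n)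

  S-*-prime : ∀ r {n q} c → Prime q → 1 ≤ n → Sfactor r (n * q) q ≡ c * Sfactor r n q
    → S r (n * q) ≡ c * S r n
  S-*-prime r {n} {q} c pq 1≤n factor-q = begin
    S r (n * q)                  ≡⟨ prodTo-scale-at (n * q) c (m≤n*m q n) (Sfactor-*-≢ r pq 1≤n) factor-q ⟩
    c * prodTo (n * q) (Sfactor r n) ≡⟨ cong (c *_) (prodTo-Sfactor r 1≤n (m≤m*n n q)) ⟩
    c * S r n                    ∎
    where
    open ≡-Reasoning
    instance
      _ = >-nonZero 1≤n
      _ = prime⇒nonZero pq

  S-*-prime-∤ : ∀ r {n q} → Prime q → 1 ≤ n → ¬ q ∣ n → S r (n * q) ≡ (q ∸ r) * S r n
  S-*-prime-∤ r {q = q} pq 1≤n q∤n = S-*-prime r (q ∸ r) pq 1≤n (Sfactor-*-∤ r pq 1≤n q∤n)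

  S-*-prime-∣ : ∀ r {n q} → Prime q → 1 ≤ n → q ∣ n → S r (n * q) ≡ q * S r n
  S-*-prime-∣ r {q = q} pq 1≤n q∣n = S-*-prime r q pq 1≤n (Sfactor-*-∣ r pq 1≤n q∣n)

  S-*-prime-≤ : ∀ r {n q} → Prime q → 1 ≤ n → S r (n * q) ≤ q * S r n
  S-*-prime-≤ r {n} {q} pq 1≤n with q ∣? n
  ... | yes q∣n = ≤-reflexive (S-*-prime-∣ r pq 1≤n q∣n)
  ... | no  q∤n = ≤-trans (≤-reflexive (S-*-prime-∤ r pq 1≤n q∤n)) (*-monoˡ-≤ (S r n) (m∸n≤m q r))

  S-*-prime-≥ : ∀ r {n q} → Prime q → 1 ≤ n → (q ∸ r) * S r n ≤ S r (n * q)
  S-*-prime-≥ r {n} {q} pq 1≤n with q ∣? n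
  ... | yes q∣n = ≤-trans (*-monoˡ-≤ (S r n) (m∸n≤m q r)) (≤-reflexive (sym (S-*-prime-∣ r pq 1≤n q∣n)))
  ... | no  q∤n = ≤-reflexive (sym (S-*-prime-∤ r pq 1≤n q∤n))

module Exchange where

  open import Data.Nat
  open import Data.Nat.Properties
  open import Algebra.Properties.CommutativeSemigroup *-commutativeSemigroup using (x∙yz≈y∙xz; xy∙z≈xz∙y)
  open import Data.Nat.Divisibility using (_∣_)
  open import Data.Nat.Primality using (Prime; prime⇒nonZero; productOfPrimes≥1)
  open import Data.Nat.Primality.Factorisation using (factorise; PrimeFactorisation)
  open import Data.Nat.ListAction using (product)
  open import Data.Nat.ListAction.Properties using (∈⇒∣product)
  open import Data.List using ([]; _∷_)
  open import Data.List.Relation.Unary.All as All using (All; []; _∷_)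
  open import Relation.Nullary using (¬_)
  open import Relation.Binary.PropositionalEquality
  open import Defs using (S)
  open Multiplicativity using (S-*-prime-∤; S-*-prime-≤; S-*-prime-≥)

  private
    *-product-∷ : ∀ n a as → n * product (a ∷ as) ≡ n * product as * a
    *-product-∷ n a as = trans (cong (n *_) (*-comm a (product as))) (sym (*-assoc n (product as) a))

  S-*-product-≤ : ∀ r {n as} → 1 ≤ n → All Prime as → S r (n * product as) ≤ S r n * product as
  S-*-product-≤ r {n} 1≤n [] = ≤-reflexive (trans (cong (S r) (*-identityʳ n)) (sym (*-identityʳ (S r n))))
  S-*-product-≤ r {n} {a ∷ as} 1≤n (pa ∷ pas) = begin
    S r (n * product (a ∷ as))     ≡⟨ cong (S r) (*-product-∷ n a as) ⟩
    S r (n * product as * a)       ≤⟨ S-*-prime-≤ r pa (*-mono-≤ 1≤n (productOfPrimes≥1 pas)) ⟩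
    a * S r (n * product as)       ≤⟨ *-monoʳ-≤ a (S-*-product-≤ r 1≤n pas) ⟩
    a * (S r n * product as)       ≡⟨ x∙yz≈y∙xz a (S r n) (product as) ⟩
    S r n * product (a ∷ as)       ∎
    where open ≤-Reasoning

  S-*-product-pos : ∀ r {n as} → 1 ≤ n → All Prime as → All (r <_) as → 0 < S r n → 0 < S r (n * product as)
  S-*-product-pos r {n} 1≤n [] [] 0<Sn = subst (λ m → 0 < S r m) (sym (*-identityʳ n)) 0<Sn
  S-*-product-pos r {n} {a ∷ as} 1≤n (pa ∷ pas) (r<a ∷ r<as) 0<Sn = begin-strict
    0                             <⟨ *-mono-< (m<n⇒0<n∸m r<a) (S-*-product-pos r 1≤n pas r<as 0<Sn) ⟩
    (a ∸ r) * S r (n * product as) ≤⟨ S-*-prime-≥ r pa (*-mono-≤ 1≤n (productOfPrimes≥1 pas)) ⟩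
    S r (n * product as * a)       ≡⟨ cong (S r) (*-product-∷ n a as) ⟨
    S r (n * product (a ∷ as))     ∎
    where open ≤-Reasoning

  S-*-≤ : ∀ r {n} t .{{_ : NonZero t}} → 1 ≤ n → S r (n * t) ≤ S r n * t
  S-*-≤ r {n} t 1≤n =
    subst (λ m → S r (n * m) ≤ S r n * m) (sym isFactorisation) (S-*-product-≤ r 1≤n factorsPrime)
    where open PrimeFactorisation (factorise t)

  S-*-pos : ∀ r {n} t .{{_ : NonZero t}} → 1 ≤ n → (∀ {ℓ} → Prime ℓ → ℓ ∣ t → r < ℓ)
    → 0 < S r n → 0 < S r (n * t)
  S-*-pos r {n} t 1≤n large 0<Sn =
    subst (λ m → 0 < S r (n * m)) (sym isFactorisation) (S-*-product-pos r 1≤n factorsPrime factors-large 0<Sn)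
    where
    open PrimeFactorisation (factorise t)
    factors-large : All (r <_) factors
    factors-large = All.tabulate λ a∈ →
      large (All.lookup factorsPrime a∈) (subst (_ ∣_) (sym isFactorisation) (∈⇒∣product a∈))

  S-exchange-≤ : ∀ r {A p q} t .{{_ : NonZero t}} → 1 ≤ A → Prime p → Prime q → ¬ q ∣ A
    → (q ∸ r) * t ≤ p ∸ r → S r (A * q * t) ≤ S r (A * p)
  S-exchange-≤ r {A} {p} {q} t 1≤A pp pq q∤A [q∸r]t≤p∸r = begin
    S r (A * q * t)       ≤⟨ S-*-≤ r t (*-mono-≤ 1≤A (>-nonZero⁻¹ q)) ⟩
    S r (A * q) * t       ≡⟨ cong (_* t) (S-*-prime-∤ r pq 1≤A q∤A) ⟩
    (q ∸ r) * S r A * t   ≡⟨ xy∙z≈xz∙y (q ∸ r) (S r A) t ⟩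
    (q ∸ r) * t * S r A   ≤⟨ *-monoˡ-≤ (S r A) [q∸r]t≤p∸r ⟩
    (p ∸ r) * S r A       ≤⟨ S-*-prime-≥ r pp 1≤A ⟩
    S r (A * p)           ∎
    where
    open ≤-Reasoning
    instance _ = prime⇒nonZero pq

  S-exchange-pos : ∀ r {A p q} t .{{_ : NonZero t}} → 1 ≤ A → Prime p → Prime q → r < q
    → (∀ {ℓ} → Prime ℓ → ℓ ∣ t → r < ℓ) → 0 < S r (A * p) → 0 < S r (A * q * t)
  S-exchange-pos r {A} {p} {q} t 1≤A pp pq r<q large 0<S[Ap] =
    S-*-pos r t (*-mono-≤ 1≤A (>-nonZero⁻¹ q)) large (<-≤-trans 0<S[Aq] (S-*-prime-≥ r pq 1≤A))
    where
    instance _ = prime⇒nonZero pq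
    0<SA : 0 < S r A
    0<SA = >-nonZero⁻¹ (S r A) {{m*n≢0⇒n≢0 p {{>-nonZero (<-≤-trans 0<S[Ap] (S-*-prime-≤ r pp 1≤A))}}}}
    0<S[Aq] : 0 < (q ∸ r) * S r A
    0<S[Aq] = *-mono-< (m<n⇒0<n∸m r<q) 0<SA

module Primorial where

  open import Data.Nat
  open import Data.Nat.Properties using (≰⇒>)
  open import Data.Nat.Divisibility using (_∣_)
  open import Data.Nat.Coprimality using (Coprime)
  open import Data.Nat.Primality
  open import Data.Product using (_,_)
  open import Relation.Nullary
  open import Relation.Binary.PropositionalEquality
  open import Defs using (primorial; primeOrOne)
  open Products using (∣-prodTo)

  primeOrOne-prime : ∀ {ℓ} → Prime ℓ → primeOrOne ℓ ≡ ℓ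
  primeOrOne-prime {ℓ} pℓ with prime? ℓ
  ... | yes _  = refl
  ... | no ¬pℓ = contradiction pℓ ¬pℓ

  prime∣primorial : ∀ {r ℓ} → Prime ℓ → ℓ ≤ r → ℓ ∣ primorial r
  prime∣primorial {r} pℓ ℓ≤r = subst (_∣ primorial r) (primeOrOne-prime pℓ) (∣-prodTo r primeOrOne ℓ≤r)

  coprime-primorial⇒> : ∀ {r t ℓ} → Coprime t (primorial r) → Prime ℓ → ℓ ∣ t → r < ℓ
  coprime-primorial⇒> coprime pℓ ℓ∣t =
    ≰⇒> λ ℓ≤r → nonTrivial⇒≢1 {{prime⇒nonTrivial pℓ}} (coprime (ℓ∣t , prime∣primorial pℓ ℓ≤r))

module Jacobsthal where

  open import Data.Nat
  open import Data.Nat.Properties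
  open import Data.Nat.DivMod using (_/_; _%_; m≡m%n+[m/n]*n; m%n<n; m/n*n≤m)
  open import Data.Nat.Coprimality using (Coprime)
  open import Data.Integer using (+_)
  open import Data.Product using (∃; _×_; _,_)
  open import Relation.Binary.PropositionalEquality
  open import Defs using (primorial; JGood)

  m<[1+m/n]*n : ∀ m n .{{_ : NonZero n}} → m < suc (m / n) * n
  m<[1+m/n]*n m n = begin-strict
    m                  ≡⟨ m≡m%n+[m/n]*n m n ⟩
    m % n + m / n * n  <⟨ +-monoˡ-< (m / n * n) (m%n<n m n) ⟩
    n + m / n * n      ∎
    where open ≤-Reasoning

  [m/n+k]*n≤m+k*n : ∀ m n k .{{_ : NonZero n}} → (m / n + k) * n ≤ m + k * n
  [m/n+k]*n≤m+k*n m n k = begin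
    (m / n + k) * n    ≡⟨ *-distribʳ-+ n (m / n) k ⟩
    m / n * n + k * n  ≤⟨ +-monoˡ-≤ (k * n) (m/n*n≤m m n) ⟩
    m + k * n          ∎
    where open ≤-Reasoning

  jacobsthal-window : ∀ {r J} → JGood (primorial r) J → ∀ p q .{{_ : NonZero q}}
    → ∃ λ t → Coprime t (primorial r) × p < t * q × t * q ≤ p + J * q
  jacobsthal-window {r} {J} good p q with good (+ suc (p / q))
  ... | i , i<J , coprime = suc (p / q) + i , coprime , p<tq , tq≤p+Jq
    where
    open ≤-Reasoning
    p<tq : p < (suc (p / q) + i) * q
    p<tq = <-≤-trans (m<[1+m/n]*n p q) (*-monoˡ-≤ q (m≤m+n (suc (p / q)) i))
    tq≤p+Jq : (suc (p / q) + i) * q ≤ p + J * q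
    tq≤p+Jq = begin
      (suc (p / q) + i) * q   ≡⟨ cong (_* q) (+-suc (p / q) i) ⟨
      (p / q + suc i) * q     ≤⟨ [m/n+k]*n≤m+k*n p q (suc i) ⟩
      p + suc i * q           ≤⟨ +-monoʳ-≤ p (*-monoˡ-≤ q i<J) ⟩
      p + J * q               ∎

module KeyInequality where

  open import Data.Nat
  open import Data.Nat.Properties
  open import Data.Nat.Tactic.RingSolver using (solve)
  open import Data.List using ([]; _∷_)
  open import Relation.Binary.PropositionalEquality

  private
    -- the case q = r + d, p = r + e of [q∸r]*t≤p∸r
    d*t≤e : ∀ r d e J t .{{_ : NonZero (r + d)}}
      → r * (r + d) + J * (r + d) * (r + d) ≤ r * (r + e) + r * J * (r + d)
      → t * (r + d) ≤ (r + e) + J * (r + d) → d * t ≤ e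
    d*t≤e r d e J t H T = *-cancelˡ-≤ (r + d) (begin
      (r + d) * (d * t)                  ≡⟨ solve (r ∷ d ∷ t ∷ []) ⟩
      d * (t * (r + d))                  ≤⟨ *-monoʳ-≤ d T ⟩
      d * ((r + e) + J * (r + d))        ≡⟨ solve (r ∷ d ∷ e ∷ J ∷ []) ⟩
      d * e + (r * d + d * J * (r + d))  ≤⟨ +-monoʳ-≤ (d * e) H′ ⟩
      d * e + r * e                      ≡⟨ solve (r ∷ d ∷ e ∷ []) ⟩
      (r + d) * e                        ∎)
      where
      open ≤-Reasoning
      H′ : r * d + d * J * (r + d) ≤ r * e
      H′ = +-cancelˡ-≤ (r * r + r * J * (r + d)) _ _ (begin
        r * r + r * J * (r + d) + (r * d + d * J * (r + d))  ≡⟨ solve (r ∷ d ∷ J ∷ []) ⟩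
        r * (r + d) + J * (r + d) * (r + d)                  ≤⟨ H ⟩
        r * (r + e) + r * J * (r + d)                        ≡⟨ solve (r ∷ d ∷ e ∷ J ∷ []) ⟩
        r * r + r * J * (r + d) + r * e                      ∎)

  [q∸r]*t≤p∸r : ∀ {r q p J t} → 1 ≤ r → r < q → r * q + J * q * q ≤ r * p + r * J * q
    → t * q ≤ p + J * q → (q ∸ r) * t ≤ p ∸ r
  [q∸r]*t≤p∸r {r} {q} {p} {J} {t} 1≤r r<q H T =
    d*t≤e r (q ∸ r) (p ∸ r) J t {{>-nonZero (≤-trans 1≤r (m≤m+n r _))}} H′ T′
    where
    open ≤-Reasoning
    r*q≤r*p : r * q ≤ r * p
    r*q≤r*p = +-cancelʳ-≤ (r * J * q) _ _ (begin
      r * q + r * J * q  ≡⟨ cong (r * q +_) (solve (r ∷ J ∷ q ∷ [])) ⟩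
      r * q + J * q * r  ≤⟨ +-monoʳ-≤ (r * q) (*-monoʳ-≤ (J * q) (<⇒≤ r<q)) ⟩
      r * q + J * q * q  ≤⟨ H ⟩
      r * p + r * J * q  ∎)
    r≤p : r ≤ p
    r≤p = ≤-trans (<⇒≤ r<q) (*-cancelˡ-≤ r {{>-nonZero 1≤r}} r*q≤r*p)
    H′ : r * (r + (q ∸ r)) + J * (r + (q ∸ r)) * (r + (q ∸ r)) ≤ r * (r + (p ∸ r)) + r * J * (r + (q ∸ r))
    H′ rewrite m+[n∸m]≡n (<⇒≤ r<q) | m+[n∸m]≡n r≤p = H
    T′ : t * (r + (q ∸ r)) ≤ (r + (p ∸ r)) + J * (r + (q ∸ r))
    T′ rewrite m+[n∸m]≡n (<⇒≤ r<q) | m+[n∸m]≡n r≤p = T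

module Minimality where

  open import Data.Nat
  open import Data.Nat.Properties
  open import Data.Nat.Divisibility
  open import Data.Nat.Primality
  open import Algebra.Properties.CommutativeSemigroup *-commutativeSemigroup using (x∙yz≈xz∙y)
  open import Data.Product using (_,_)
  open import Relation.Nullary
  open import Relation.Binary.PropositionalEquality
  open import Defs using (S; B; F; JGood; primorial)
  open Exchange using (S-exchange-≤; S-exchange-pos)
  open Primorial using (coprime-primorial⇒>)
  open Jacobsthal using (jacobsthal-window)
  open KeyInequality using ([q∸r]*t≤p∸r)

  F⇒prime-bound : ∀ {r n J p q} → 1 ≤ r → F r n → JGood (primorial r) J
    → Prime p → p ∣ n → Prime q → r < q → ¬ q ∣ n
    → r * p + r * J * q < r * q + J * q * q
  F⇒prime-bound {r} {n} {J} {p} {q} 1≤r ((1≤n , 0<Sn) , minimal) good pp p∣n pq r<q q∤n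
    with jacobsthal-window {r} good p q {{prime⇒nonZero pq}}
  ... | t , coprime , p<tq , tq≤p+Jq = ≰⇒> λ H → <⇒≱ (minimal m m∈B n<m) (Sm≤Sn H)
    where
    instance
      _ = prime⇒nonZero pq
      _ = m*n≢0⇒m≢0 t {{>-nonZero (≤-<-trans z≤n p<tq)}}
    A : ℕ
    A = quotient p∣n
    n≡A*p : n ≡ A * p
    n≡A*p = _∣_.equality p∣n
    1≤A : 1 ≤ A
    1≤A = >-nonZero⁻¹ A {{m*n≢0⇒m≢0 A {{subst NonZero n≡A*p (>-nonZero 1≤n)}}}}
    q∤A : ¬ q ∣ A
    q∤A q∣A = q∤n (subst (q ∣_) (sym n≡A*p) (∣-trans q∣A (m∣m*n p)))
    m : ℕ
    m = A * q * t
    n<m : n < m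
    n<m = begin-strict
      n            ≡⟨ n≡A*p ⟩
      A * p        <⟨ *-monoʳ-< A {{>-nonZero 1≤A}} p<tq ⟩
      A * (t * q)  ≡⟨ x∙yz≈xz∙y A t q ⟩
      A * q * t    ∎
      where open ≤-Reasoning
    m∈B : B r m
    m∈B = ≤-trans 1≤n (<⇒≤ n<m) ,
      S-exchange-pos r t 1≤A pp pq r<q (coprime-primorial⇒> {r} coprime) (subst (λ k → 0 < S r k) n≡A*p 0<Sn)
    Sm≤Sn : r * q + J * q * q ≤ r * p + r * J * q → S r m ≤ S r n
    Sm≤Sn H = subst (λ k → S r m ≤ S r k) (sym n≡A*p)
      (S-exchange-≤ r t 1≤A pp pq q∤A ([q∸r]*t≤p∸r 1≤r r<q H tq≤p+Jq))

module RationalForm where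

  open import Data.Nat as ℕ using (ℕ; suc; NonZero; _*_)
  import Data.Nat.Properties as ℕ
  open import Data.Integer as ℤ using (ℤ; +_; +<+)
  import Data.Integer.Properties as ℤ
  open import Data.Integer.Tactic.RingSolver using (solve-∀)
  open import Data.Rational using (_/_; _<_; _+_; _-_; 1ℚ; -_; toℚᵘ) renaming (_*_ to _*ℚ_)
  import Data.Rational.Properties as ℚ
  open import Data.Rational.Unnormalised as ℚᵘ using (mkℚᵘ; _≃_; *<*)
  import Data.Rational.Unnormalised.Properties as ℚᵘ
  open import Relation.Binary.PropositionalEquality

  toℚᵘ-/ : ∀ (i : ℤ) n → toℚᵘ (i / suc n) ≃ mkℚᵘ i n
  toℚᵘ-/ i n = ℚ.toℚᵘ-fromℚᵘ (mkℚᵘ i n)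

  private
    pos-r*p+r*J*q : ∀ r p J q → + (r * p ℕ.+ r * J * q) ≡ + r ℤ.* + p ℤ.+ + r ℤ.* + J ℤ.* + q
    pos-r*p+r*J*q r p J q = trans (ℤ.pos-+ (r * p) _)
      (cong₂ ℤ._+_ (ℤ.pos-* r p) (trans (ℤ.pos-* (r * J) q) (cong (ℤ._* + q) (ℤ.pos-* r J))))

    pos-r*q+J*q*q : ∀ r q J → + (r * q ℕ.+ J * q * q) ≡ + r ℤ.* + q ℤ.+ + J ℤ.* + q ℤ.* + q
    pos-r*q+J*q*q r q J = trans (ℤ.pos-+ (r * q) _)
      (cong₂ ℤ._+_ (ℤ.pos-* r q) (trans (ℤ.pos-* (J * q) q) (cong (ℤ._* + q) (ℤ.pos-* J q))))

    toℚᵘ-rhs : ∀ r' q J → toℚᵘ (+ q / 1 *ℚ ((1ℚ - + J / 1) + + (J * q) / suc r'))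
      ≃ mkℚᵘ (+ q) 0 ℚᵘ.* ((mkℚᵘ (+ 1) 0 ℚᵘ.- mkℚᵘ (+ J) 0) ℚᵘ.+ mkℚᵘ (+ J ℤ.* + q) r')
    toℚᵘ-rhs r' q J =
      ℚᵘ.≃-trans (ℚ.toℚᵘ-homo-* (+ q / 1) _) (ℚᵘ.*-cong (toℚᵘ-/ (+ q) 0)
        (ℚᵘ.≃-trans (ℚ.toℚᵘ-homo-+ (1ℚ - + J / 1) _) (ℚᵘ.+-cong
          (ℚᵘ.≃-trans (ℚ.toℚᵘ-homo-+ 1ℚ (- (+ J / 1))) (ℚᵘ.+-cong (toℚᵘ-/ (+ 1) 0)
            (ℚᵘ.≃-trans (ℚ.toℚᵘ-homo‿- (+ J / 1)) (ℚᵘ.-‿cong (toℚᵘ-/ (+ J) 0)))))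
          (ℚᵘ.≃-trans (toℚᵘ-/ (+ (J * q)) r') (ℚᵘ.≃-reflexive (cong (λ i → mkℚᵘ i r') (ℤ.pos-* J q)))))))

    -- The numerator, and (as suc (r' + 0 + 0) rather than suc r') the denominator,
    -- that ℚᵘ arithmetic computes for the right-hand side of toℚᵘ-rhs.
    rhs-numerator : ℕ → ℕ → ℕ → ℤ
    rhs-numerator r' q J = + q ℤ.* ((+ 1 ℤ.* + 1 ℤ.+ ℤ.- + J ℤ.* + 1) ℤ.* + suc r' ℤ.+ + J ℤ.* + q ℤ.* + 1)

    cross-multiplied : ∀ r' p q J → suc r' * p ℕ.+ suc r' * J * q ℕ.< suc r' * q ℕ.+ J * q * q
      → + p ℤ.* + suc r' ℤ.< rhs-numerator r' q J ℤ.* + 1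
    cross-multiplied r' p q J ineq = begin-strict
      P ℤ.* R                                   ≡⟨ x*y≡y*x+c-c P R C ⟩
      R ℤ.* P ℤ.+ C ℤ.- C                       ≡⟨ cong (ℤ._- C) (pos-r*p+r*J*q (suc r') p J q) ⟨
      + (suc r' * p ℕ.+ suc r' * J * q) ℤ.- C   <⟨ ℤ.+-monoˡ-< (ℤ.- C) (+<+ ineq) ⟩
      + (suc r' * q ℕ.+ J * q * q) ℤ.- C        ≡⟨ cong (ℤ._- C) (pos-r*q+J*q*q (suc r') q J) ⟩
      R ℤ.* Q ℤ.+ Jz ℤ.* Q ℤ.* Q ℤ.- C          ≡⟨ numerator-identity R Q Jz ⟩
      rhs-numerator r' q J ℤ.* + 1              ∎
      where
      open ℤ.≤-Reasoning
      P Q R Jz C : ℤ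
      P = + p
      Q = + q
      R = + suc r'
      Jz = + J
      C = R ℤ.* Jz ℤ.* Q
      x*y≡y*x+c-c : ∀ x y c → x ℤ.* y ≡ y ℤ.* x ℤ.+ c ℤ.- c
      x*y≡y*x+c-c = solve-∀
      numerator-identity : ∀ R Q J → R ℤ.* Q ℤ.+ J ℤ.* Q ℤ.* Q ℤ.- R ℤ.* J ℤ.* Q
        ≡ Q ℤ.* ((+ 1 ℤ.* + 1 ℤ.+ ℤ.- J ℤ.* + 1) ℤ.* R ℤ.+ J ℤ.* Q ℤ.* + 1) ℤ.* + 1
      numerator-identity = solve-∀

  ℕ-bound⇒ℚ-bound : ∀ r p q J .{{_ : NonZero r}} → r * p ℕ.+ r * J * q ℕ.< r * q ℕ.+ J * q * q
    → + p / 1 < + q / 1 *ℚ ((1ℚ - + J / 1) + + (J * q) / r)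
  ℕ-bound⇒ℚ-bound (suc r') p q J ineq =
    ℚ.toℚᵘ-cancel-< (ℚᵘ.<-respʳ-≃ (ℚᵘ.≃-sym (toℚᵘ-rhs r' q J))
      (ℚᵘ.<-respˡ-≃ (ℚᵘ.≃-sym (toℚᵘ-/ (+ p) 0)) (*<* cross-multiplied′)))
    where
    cross-multiplied′ : + p ℤ.* + suc (r' ℕ.+ 0 ℕ.+ 0) ℤ.< rhs-numerator r' q J ℤ.* + 1
    cross-multiplied′ rewrite ℕ.+-identityʳ r' | ℕ.+-identityʳ r' = cross-multiplied r' p q J ineq

open import Defs
open import Data.Nat using (ℕ; NonZero; _≤_; _*_; >-nonZero⁻¹)
open import Data.Integer using (+_)
open import Data.Rational using (_/_; _<_; _+_; _-_; 1ℚ) renaming (_*_ to _*ℚ_)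
open import Data.Product using (_,_)
open Minimality using (F⇒prime-bound)
open RationalForm using (ℕ-bound⇒ℚ-bound)

lemma3p4 : (r n : ℕ) → .{{_ : NonZero r}} → .{{_ : NonZero n}}
    → 2 ≤ ω n → F r n
    → (J p q : ℕ) → IsJ (primorial r) J → IsP₁ n p → IsQ₁ r n q
    → (+ p / 1) < (+ q / 1) *ℚ ((1ℚ - (+ J / 1)) + (+ (J * q) / r))
lemma3p4 r n _ n∈F J p q (_ , J-good , _) (p-prime , p∣n , _) (q-prime , r<q , q∤n , _) =
  ℕ-bound⇒ℚ-bound r p q J (F⇒prime-bound (>-nonZero⁻¹ r) n∈F J-good p-prime p∣n q-prime r<q q∤n)
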